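{- Let $a$ and $k$ be positive integers and set $h=(k-1)(2a+k)+2a-1$. For $p\in\{1,\ldots,a+k\}$ define $$D_p=\begin{cases}\{ph+p(p-1)+2pi:\ i\in\{1,\ldots,k+1\}\}, & p\in\{1,\ldots,a\},\\ \{ph+p(p-1)+2pi:\ i\in\{1,\ldots,(k+1)-(p-a)\}\}, & p\in\{a+1,\ldots,a+k\}.\end{cases}$$ Then the sets $D_p$, $p\in\{1,\ldots,a+k\}$, are pairwise disjoint. -}

module Defs where

open import Data.Nat using (ℕ; _+_; _*_; _∸_; _≤_)
open import Data.Nat using (_≤ᵇ_)
open import Data.Bool using (if_then_else_)
open import Data.Product using (∃; _×_)
open import Relation.Binary.PropositionalEquality using (_≡_)

-- h = (k-1)(2a+k) + 2a - 1  (for a, k ≥ 1 all subtractions are exact)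
h : ℕ → ℕ → ℕ
h a k = (k ∸ 1) * (2 * a + k) + 2 * a ∸ 1

bound : ℕ → ℕ → ℕ → ℕ
bound a k p = if p ≤ᵇ a then k + 1 else (k + 1) ∸ (p ∸ a)

InD : ℕ → ℕ → ℕ → ℕ → Set
InD a k p x = ∃ λ i → (1 ≤ i) × (i ≤ bound a k p) × (x ≡ p * h a k + p * (p ∸ 1) + 2 * p * i)

module Submission where

-- Lower end of a block.  Since i ≥ 1 every element of D_q is at least
-- blockStart H q = q(H + q + 1), and blockStart is monotone in q.
--
-- If 2p·i ≤ H + 1 + 2p, then
-- p·H + p(p-1) + 2p·i  <  blockStart H (p + 1).  For i ranging up to the
-- size  bound a k p  of D_p this bound is the arithmetic heart of the
-- paper's argument (the "span" lemma): 2p·bound ≤ h + 1 + 2p, checked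
-- separately for p ≤ a (size k + 1) and p = a + j with 1 ≤ j ≤ k (size
-- k + 1 - j), after unfolding h + 1 = (k-1)(2a+k) + 2a.
--
-- Hence for p < q every element of D_p lies strictly below
-- blockStart H (p+1) ≤ blockStart H q, which is below every element of D_q.

open import Defs
open import Data.Nat using (ℕ; zero; suc; _+_; _*_; _∸_; _≤_; _<_; z≤n; s≤s; s≤s⁻¹; _≤ᵇ_)
open import Data.Product using (_×_; _,_)
open import Relation.Nullary using (¬_; yes; no)

open import Data.Nat.Properties
open import Data.Nat.Tactic.RingSolver using (solve-∀)
open import Data.Bool using (true; false)
open import Data.Unit using (tt)
open import Data.Empty using (⊥; ⊥-elim)
open import Relation.Binary using (tri<; tri≈; tri>)
open import Relation.Binary.PropositionalEquality using (_≡_; refl; sym; cong; subst; trans; module ≡-Reasoning)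

≤-bySlack : ∀ {x y} s → x + s ≡ y → x ≤ y
≤-bySlack {x} s eq = subst (x ≤_) eq (m≤m+n x s)

element : ℕ → ℕ → ℕ → ℕ
element H p i = p * H + p * (p ∸ 1) + 2 * p * i

blockStart : ℕ → ℕ → ℕ
blockStart H p = p * (H + p + 1)

blockStart≤element : ∀ H p i → 1 ≤ p → 1 ≤ i → blockStart H p ≤ element H p i
blockStart≤element H (suc p) i _ 1≤i =
  subst (_≤ element H (suc p) i) (start≡ H p)
    (+-monoʳ-≤ (suc p * H + suc p * p) (*-monoʳ-≤ (2 * suc p) 1≤i))
  where
  start≡ : ∀ H p → suc p * H + suc p * p + 2 * suc p * 1 ≡ suc p * (H + suc p + 1)
  start≡ = solve-∀

blockStart-mono : ∀ H {p q} → p ≤ q → blockStart H p ≤ blockStart H q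
blockStart-mono H p≤q = *-mono-≤ p≤q (+-monoˡ-≤ 1 (+-monoʳ-≤ H p≤q))

element<nextStart : ∀ H p i → 1 ≤ p → 2 * p * i ≤ H + 1 + 2 * p →
                    element H p i < blockStart H (suc p)
element<nextStart H (suc p) i _ range = begin-strict
  suc p * H + suc p * p + 2 * suc p * i
    ≤⟨ +-monoʳ-≤ (suc p * H + suc p * p) range ⟩
  suc p * H + suc p * p + (H + 1 + 2 * suc p)
    <⟨ ≤-bySlack (2 * suc p) (slack H p) ⟩
  blockStart H (suc (suc p)) ∎
  where
  open ≤-Reasoning
  slack : ∀ H p → suc (suc p * H + suc p * p + (H + 1 + 2 * suc p)) + 2 * suc p
                  ≡ suc (suc p) * (H + suc (suc p) + 1)
  slack = solve-∀

-- For a ≥ 1 the truncated subtraction in h is exact: h + 1 = (k-1)(2a+k) + 2a.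
h+1≡ : ∀ a k → 1 ≤ a → h a k + 1 ≡ (k ∸ 1) * (2 * a + k) + 2 * a
h+1≡ (suc a) k _ = m∸n+n≡m (≤-trans (s≤s z≤n) (m≤n+m (2 * suc a) ((k ∸ 1) * (2 * suc a + k))))

bound-low : ∀ {a k p} → p ≤ a → bound a k p ≡ k + 1
bound-low {a} {k} {p} p≤a with p ≤ᵇ a | ≤⇒≤ᵇ p≤a
... | true  | _  = refl
... | false | ()

bound-high : ∀ {a k p} → a < p → bound a k p ≡ k + 1 ∸ (p ∸ a)
bound-high {a} {k} {p} a<p with p ≤ᵇ a | ≤ᵇ⇒≤ p a
... | true  | p≤a = ⊥-elim (<⇒≱ a<p (p≤a tt))
... | false | _   = refl

bound-above : ∀ a j' m → bound a (suc (j' + m)) (suc (a + j')) ≡ m + 1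
bound-above a j' m = begin
  bound a (suc (j' + m)) (suc (a + j'))
    ≡⟨ bound-high {a} {suc (j' + m)} (s≤s (m≤m+n a j')) ⟩
  suc (j' + m) + 1 ∸ (suc (a + j') ∸ a)
    ≡⟨ cong (suc (j' + m) + 1 ∸_) p∸a≡ ⟩
  j' + m + 1 ∸ j'
    ≡⟨ cong (_∸ j') (+-assoc j' m 1) ⟩
  j' + (m + 1) ∸ j'
    ≡⟨ m+n∸m≡n j' (m + 1) ⟩
  m + 1 ∎
  where
  open ≡-Reasoning
  p∸a≡ : suc (a + j') ∸ a ≡ suc j'
  p∸a≡ = trans (cong (_∸ a) (sym (+-suc a j'))) (m+n∸m≡n a (suc j'))

-- Span inequality for p ≤ a, written with a = p + e and k = k' + 1.
span-below : ∀ k' p e →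
  2 * p * bound (p + e) (suc k') p ≤ k' * (2 * (p + e) + suc k') + 2 * (p + e) + 2 * p
span-below k' p e rewrite bound-low {p + e} {suc k'} (m≤m+n p e) =
  ≤-bySlack (2 * e * k' + k' * suc k' + 2 * e) (slack k' p e)
  where
  slack : ∀ k' p e → 2 * p * (suc k' + 1) + (2 * e * k' + k' * suc k' + 2 * e)
                     ≡ k' * (2 * (p + e) + suc k') + 2 * (p + e) + 2 * p
  slack = solve-∀

-- Span inequality for a < p, written with p = a + j' + 1 and k = j' + m + 1.
-- The slack contains m(m-1), hence the split on m.
span-above : ∀ a j' m →
  2 * suc (a + j') * bound a (suc (j' + m)) (suc (a + j'))
    ≤ (j' + m) * (2 * a + suc (j' + m)) + 2 * a + 2 * suc (a + j')
span-above a j' m rewrite bound-above a j' m = bySize m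
  where
  bySize : ∀ m → 2 * suc (a + j') * (m + 1)
                   ≤ (j' + m) * (2 * a + suc (j' + m)) + 2 * a + 2 * suc (a + j')
  bySize zero = ≤-bySlack (2 * a * j' + j' + j' * j' + 2 * a) (slack a j')
    where
    slack : ∀ a j' → 2 * suc (a + j') * (0 + 1) + (2 * a * j' + j' + j' * j' + 2 * a)
                     ≡ (j' + 0) * (2 * a + suc (j' + 0)) + 2 * a + 2 * suc (a + j')
    slack = solve-∀
  bySize (suc n) = ≤-bySlack (2 * a * j' + j' + j' * j' + n * n + n + 2 * a) (slack a j' n)
    where
    slack : ∀ a j' n → 2 * suc (a + j') * (suc n + 1) + (2 * a * j' + j' + j' * j' + n * n + n + 2 * a)
                       ≡ (j' + suc n) * (2 * a + suc (j' + suc n)) + 2 * a + 2 * suc (a + j')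
    slack = solve-∀

span : ∀ a k p → 1 ≤ a → 1 ≤ k → p ≤ a + k → 2 * p * bound a k p ≤ h a k + 1 + 2 * p
span a (suc k') p 1≤a _ p≤a+k rewrite h+1≡ a (suc k') 1≤a with p ≤? a
... | yes p≤a with e , refl ← m≤n⇒∃[o]m+o≡n p≤a = span-below k' p e
... | no p≰a with j' , refl ← m≤n⇒∃[o]m+o≡n (≰⇒> p≰a)
  with m , refl ← m≤n⇒∃[o]m+o≡n (+-cancelˡ-≤ a j' k' (s≤s⁻¹ (subst (p ≤_) (+-suc a k') p≤a+k)))
  = span-above a j' m

D-ordered : ∀ a k p q → 1 ≤ a → 1 ≤ k → 1 ≤ p → p ≤ a + k → p < q →
            (x : ℕ) → InD a k p x → InD a k q x → ⊥
D-ordered a k p q 1≤a 1≤k 1≤p p≤a+k p<q x (i , _ , i≤bound , refl) (j , 1≤j , _ , x≡) =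
  <-irrefl x≡ (begin-strict
    element H p i             <⟨ element<nextStart H p i 1≤p span-i ⟩
    blockStart H (suc p)      ≤⟨ blockStart-mono H p<q ⟩
    blockStart H q            ≤⟨ blockStartLow ⟩
    element H q j             ∎)
  where
  open ≤-Reasoning
  H = h a k
  span-i : 2 * p * i ≤ H + 1 + 2 * p
  span-i = ≤-trans (*-monoʳ-≤ (2 * p) i≤bound) (span a k p 1≤a 1≤k p≤a+k)
  blockStartLow : blockStart H q ≤ element H q j
  blockStartLow = blockStart≤element H q j (≤-trans 1≤p (<⇒≤ p<q)) 1≤j

lemma3p2 : (a k : ℕ) → 1 ≤ a → 1 ≤ k →
    (p q : ℕ) → 1 ≤ p → p ≤ a + k → 1 ≤ q → q ≤ a + k → ¬ (p ≡ q) →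
    (x : ℕ) → ¬ (InD a k p x × InD a k q x)
lemma3p2 a k 1≤a 1≤k p q 1≤p p≤a+k 1≤q q≤a+k p≢q x (x∈Dp , x∈Dq) with <-cmp p q
... | tri< p<q _ _ = D-ordered a k p q 1≤a 1≤k 1≤p p≤a+k p<q x x∈Dp x∈Dq
... | tri≈ _ p≡q _ = p≢q p≡q
... | tri> _ _ q<p = D-ordered a k q p 1≤a 1≤k 1≤q q≤a+k q<p x x∈Dq x∈Dp
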